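{- Let $n\geq 4$ be an integer and let $a,b$ be non-zero rational numbers. Then the system of Diophantine equations \[ \sigma_{1}(x_{1},\ldots,x_{n})=a,\qquad \sigma_{n}(x_{1},\ldots,x_{n})=b \] has infinitely many rational parametric solutions depending on $n-3$ free parameters; that is, there are infinitely many distinct $n$-tuples $(x_1,\ldots,x_n)$ of rational functions in $n-3$ independent indeterminates over $\mathbb{Q}$ which satisfy the system identically.
   Context: For $1\leq i\leq n$, $\sigma_{i}(x_{1},\ldots,x_{n})=\sum_{1\leq k_{1}<k_{2}<\cdots<k_{i}\leq n}x_{k_{1}}\cdots x_{k_{i}}$ denotes the $i$-th elementary symmetric polynomial; in particular $\sigma_1$ is the sum and $\sigma_n$ the product of the variables. -}

module Defs where

open import Data.Nat using (ℕ; zero; suc)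
open import Data.Fin using (Fin; zero; suc; punchIn)
open import Data.Rational using (ℚ; 0ℚ; 1ℚ; _+_; _*_; -_; _-_; 1/_)
open import Data.Rational.Properties using (_≟_)
open import Data.Rational.Base using (≢-nonZero)
open import Data.Product using (Σ; ∃; _×_; _,_)
open import Relation.Nullary using (¬_; yes; no)
open import Relation.Binary.PropositionalEquality using (_≡_; _≢_)
open import Function.Definitions using (Injective)

σ : ℕ → (n : ℕ) → (Fin n → ℚ) → ℚ
σ zero    n       x = 1ℚ
σ (suc i) zero    x = 0ℚ
σ (suc i) (suc n) x = x zero * σ i n (λ j → x (suc j)) + σ (suc i) n (λ j → x (suc j))

data Poly (k : ℕ) : Set where
  var  : Fin k → Poly k
  con  : ℚ → Poly k
  _⊕_  : Poly k → Poly k → Poly k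
  _⊗_  : Poly k → Poly k → Poly k

⟦_⟧ : ∀ {k} → Poly k → (Fin k → ℚ) → ℚ
⟦ var i ⟧ t = t i
⟦ con c ⟧ t = c
⟦ p ⊕ q ⟧ t = ⟦ p ⟧ t + ⟦ q ⟧ t
⟦ p ⊗ q ⟧ t = ⟦ p ⟧ t * ⟦ q ⟧ t

∂ : ∀ {k} → Fin k → Poly k → Poly k
∂ j (var i) with Data.Fin._≟_ i j
... | yes _ = con 1ℚ
... | no  _ = con 0ℚ
∂ j (con c) = con 0ℚ
∂ j (p ⊕ q) = ∂ j p ⊕ ∂ j q
∂ j (p ⊗ q) = (∂ j p ⊗ q) ⊕ (p ⊗ ∂ j q)

record RatFun (k : ℕ) : Set where
  constructor _//_
  field
    num : Poly k
    den : Poly k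
open RatFun public

-- total inverse on ℚ (only ever used at non-zero arguments)
inv : ℚ → ℚ
inv q with q ≟ 0ℚ
... | yes _  = 0ℚ
... | no q≢0 = 1/_ q {{≢-nonZero q≢0}}

DefinedAt : ∀ {k} → RatFun k → (Fin k → ℚ) → Set
DefinedAt f t = ⟦ den f ⟧ t ≢ 0ℚ

-- value of f at t (meaningful when DefinedAt f t)
val : ∀ {k} → RatFun k → (Fin k → ℚ) → ℚ
val f t = ⟦ num f ⟧ t * inv (⟦ den f ⟧ t)

dval : ∀ {k} → Fin k → RatFun k → (Fin k → ℚ) → ℚ
dval j f t =
  (⟦ ∂ j (num f) ⟧ t * ⟦ den f ⟧ t - ⟦ num f ⟧ t * ⟦ ∂ j (den f) ⟧ t)
  * inv (⟦ den f ⟧ t * ⟦ den f ⟧ t)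

sumFin : ∀ k → (Fin k → ℚ) → ℚ
sumFin zero    f = 0ℚ
sumFin (suc k) f = f zero + sumFin k (λ j → f (suc j))

sign : ∀ {k} → Fin k → ℚ
sign zero    = 1ℚ
sign (suc j) = - sign j

det : ∀ k → (Fin k → Fin k → ℚ) → ℚ
det zero    M = 1ℚ
det (suc k) M =
  sumFin (suc k) (λ j → sign j * M zero j * det k (λ r c → M (suc r) (punchIn j c)))

Tuple : ℕ → ℕ → Set
Tuple n k = Fin n → RatFun k

AllDefinedAt : ∀ {n k} → Tuple n k → (Fin k → ℚ) → Set
AllDefinedAt x t = ∀ m → DefinedAt (x m) t

SolvesIdentically : ∀ n {k} → ℚ → ℚ → Tuple n k → Set
SolvesIdentically n a b x =
  ∀ t → AllDefinedAt x t →
    (σ 1 n (λ m → val (x m) t) ≡ a) × (σ n n (λ m → val (x m) t) ≡ b)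

-- x genuinely depends on k independent parameters: the Jacobian
-- (∂x_m/∂t_j) has rank k over ℚ(t), i.e. some k×k minor is a non-zero
-- rational function, i.e. is non-zero at some point where x is defined.
IndependentParams : ∀ n k → Tuple n k → Set
IndependentParams n k x =
  Σ (Fin k → ℚ) λ t → AllDefinedAt x t ×
  Σ (Fin k → Fin n) λ ρ → Injective _≡_ _≡_ ρ ×
    det k (λ r j → dval j (x (ρ r)) t) ≢ 0ℚ

DistinctTuples : ∀ {n k} → Tuple n k → Tuple n k → Set
DistinctTuples x y =
  Σ _ λ t → AllDefinedAt x t × AllDefinedAt y t ×
  Σ _ λ m → val (x m) t ≢ val (y m) t

-- Let t_0,…,t_{n−5} be free parameters with sum S and product P, let β be one more parameter
-- and c ≥ 1 a scale, and put A = a − S, g = cβ, E = g² − bP, D = gAP. The tuple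
-- (E/D, −E/D, g²A/E, −bPA/E, t_0, …, t_{n−5}) has σ₁ = 0 + A + S = a and
-- σₙ = (−E²/D²)(−bPg²A²/E²)P = b. Listing the rows t_0, …, t_{n−5}, g²A/E of its Jacobian
-- with β as the last parameter gives a lower triangular matrix with diagonal 1, …, 1,
-- ∂(g²A/E)/∂β = −2cgAbP/E², so the n − 3 parameters are independent. At a point with every
-- t_i = −a and β > |bP| both A and E stay non-zero, and there the entry −bPA/E separates the
-- tuples for c = 1, 2, 3, ….
module Submission where

open import Defs
open import Data.Nat using (ℕ; _≤_; _∸_)
open import Data.Rational using (ℚ; 0ℚ)
open import Data.Product using (Σ; _×_)
open import Relation.Binary.PropositionalEquality using (_≢_)

open import Algebra.Bundles using (CommutativeRing)
open import Data.Fin as Fin using (Fin; zero; suc; inject₁; fromℕ; toℕ)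
import Data.Fin.Properties as FinP
open import Data.Fin.Relation.Unary.Top using (View; view; ‵fromℕ; ‵inject₁)
open import Data.List using ([]; _∷_)
open import Data.Maybe using (just; nothing)
open import Data.Nat as ℕ using (zero; suc; z≤n; s≤s)
import Data.Nat.Properties as ℕP
open import Data.Product using (_,_)
open import Data.Rational as ℚ using (1ℚ; _+_; _*_; -_; _-_; ∣_∣)
import Data.Rational.Properties as ℚP
open ℚP using (+-*-commutativeRing; heytingCommutativeRing; +-0-group; _≟_)
open import Data.Vec.Functional using (updateAt)
open import Data.Vec.Functional.Properties using (updateAt-updates; updateAt-minimal)
open import Level using (0ℓ)
open import Relation.Binary.PropositionalEquality
  using (_≡_; refl; sym; trans; cong; cong₂; subst; module ≡-Reasoning)
open import Relation.Nullary using (yes; no; contradiction)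
import Tactic.RingSolver.Core.AlmostCommutativeRing as ACR
open import Tactic.RingSolver using (solve-∀; solve)

open CommutativeRing +-*-commutativeRing using (*-commutativeSemigroup)
open import Algebra.Apartness.Properties.HeytingCommutativeRing heytingCommutativeRing
  using (x#0y#0→xy#0)
open import Algebra.Properties.Group +-0-group using (x∙y⁻¹≈ε⇒x≈y; quasigroup)
open import Algebra.Properties.Quasigroup quasigroup using () renaming (cancelˡ to +-cancelˡ)
open import Algebra.Properties.CommutativeSemigroup *-commutativeSemigroup using (x∙yz≈y∙xz)

-- The reflective solver only normalises if it can recognise the zero coefficient.
ℚ-ring : ACR.AlmostCommutativeRing 0ℓ 0ℓ
ℚ-ring = ACR.fromCommutativeRing +-*-commutativeRing 0≟
  where
  0≟ : ∀ q → _
  0≟ q with 0ℚ ≟ q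
  ... | yes 0≡q = just 0≡q
  ... | no _    = nothing

*-inv : ∀ {q} → q ≢ 0ℚ → q * inv q ≡ 1ℚ
*-inv {q} q≢0 with q ≟ 0ℚ
... | yes q≡0  = contradiction q≡0 q≢0
... | no  q≢0′ = ℚP.*-inverseʳ q {{ℚ.≢-nonZero q≢0′}}

*≢0 : ∀ {p q} → p ≢ 0ℚ → q ≢ 0ℚ → p * q ≢ 0ℚ
*≢0 = x#0y#0→xy#0

neg≢0 : ∀ {p} → p ≢ 0ℚ → - p ≢ 0ℚ
neg≢0 p≢0 -p≡0 = p≢0 (ℚP.neg-injective -p≡0)

inv≢0 : ∀ {q} → q ≢ 0ℚ → inv q ≢ 0ℚ
inv≢0 {q} q≢0 inv≡0 =
  ℚP.1≢0 (trans (sym (*-inv q≢0)) (trans (cong (q *_) inv≡0) (ℚP.*-zeroʳ q)))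

p≢q⇒p-q≢0 : ∀ {p q} → p ≢ q → p - q ≢ 0ℚ
p≢q⇒p-q≢0 p≢q p-q≡0 = p≢q (x∙y⁻¹≈ε⇒x≈y _ _ p-q≡0)

*-cancelˡ : ∀ {p q r} → p ≢ 0ℚ → p * q ≡ p * r → q ≡ r
*-cancelˡ {p} {q} {r} p≢0 pq≡pr = begin
  q                ≡⟨ ℚP.*-identityˡ q ⟨
  1ℚ * q           ≡⟨ cong (_* q) inv[p]*p≡1 ⟨
  inv p * p * q    ≡⟨ ℚP.*-assoc (inv p) p q ⟩
  inv p * (p * q)  ≡⟨ cong (inv p *_) pq≡pr ⟩
  inv p * (p * r)  ≡⟨ ℚP.*-assoc (inv p) p r ⟨
  inv p * p * r    ≡⟨ cong (_* r) inv[p]*p≡1 ⟩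
  1ℚ * r           ≡⟨ ℚP.*-identityˡ r ⟩
  r                ∎
  where
  open ≡-Reasoning
  inv[p]*p≡1 : inv p * p ≡ 1ℚ
  inv[p]*p≡1 = trans (ℚP.*-comm (inv p) p) (*-inv p≢0)

inv-injective : ∀ {p q} → p ≢ 0ℚ → q ≢ 0ℚ → inv p ≡ inv q → p ≡ q
inv-injective {p} {q} p≢0 q≢0 inv[p]≡inv[q] = begin
  p                  ≡⟨ ℚP.*-identityʳ p ⟨
  p * 1ℚ             ≡⟨ cong (p *_) (*-inv q≢0) ⟨
  p * (q * inv q)    ≡⟨ cong (λ i → p * (q * i)) inv[p]≡inv[q] ⟨
  p * (q * inv p)    ≡⟨ x∙yz≈y∙xz p q (inv p) ⟩
  q * (p * inv p)    ≡⟨ cong (q *_) (*-inv p≢0) ⟩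
  q * 1ℚ             ≡⟨ ℚP.*-identityʳ q ⟩
  q                  ∎
  where open ≡-Reasoning

0<1 : 0ℚ ℚ.< 1ℚ
0<1 = ℚP.positive⁻¹ 1ℚ

1≤⇒0< : ∀ {p} → 1ℚ ℚ.≤ p → 0ℚ ℚ.< p
1≤⇒0< = ℚP.<-≤-trans 0<1

0<⇒≢0 : ∀ {p} → 0ℚ ℚ.< p → p ≢ 0ℚ
0<⇒≢0 0<p p≡0 = ℚP.<-irrefl (sym p≡0) 0<p

1≤⇒≢0 : ∀ {p} → 1ℚ ℚ.≤ p → p ≢ 0ℚ
1≤⇒≢0 1≤p = 0<⇒≢0 (1≤⇒0< 1≤p)

p≤c*p : ∀ {c p} → 1ℚ ℚ.≤ c → 0ℚ ℚ.≤ p → p ℚ.≤ c * p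
p≤c*p {c} {p} 1≤c 0≤p =
  subst (ℚ._≤ c * p) (ℚP.*-identityˡ p) (ℚP.*-monoʳ-≤-nonNeg p {{ℚ.nonNegative 0≤p}} 1≤c)

∣q∣<p⇒p*p≢q : ∀ {p q} → ∣ q ∣ ℚ.< p → 1ℚ ℚ.≤ p → p * p ≢ q
∣q∣<p⇒p*p≢q {p} {q} ∣q∣<p 1≤p p*p≡q = ℚP.<-irrefl ∣q∣≡p*p (ℚP.<-≤-trans ∣q∣<p p≤p*p)
  where
  0≤p : 0ℚ ℚ.≤ p
  0≤p = ℚP.<⇒≤ (1≤⇒0< 1≤p)
  p≤p*p : p ℚ.≤ p * p
  p≤p*p = p≤c*p 1≤p 0≤p
  ∣q∣≡p*p : ∣ q ∣ ≡ p * p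
  ∣q∣≡p*p = trans (cong ∣_∣ (sym p*p≡q)) (ℚP.0≤p⇒∣p∣≡p (ℚP.≤-trans 0≤p p≤p*p))

scale : ℕ → ℚ
scale zero    = 1ℚ
scale (suc i) = 1ℚ + scale i

1≤scale : ∀ i → 1ℚ ℚ.≤ scale i
1≤scale zero    = ℚP.≤-refl
1≤scale (suc i) = ℚP.+-monoʳ-≤ 1ℚ (ℚP.≤-trans (ℚP.<⇒≤ 0<1) (1≤scale i))

scale-injective : ∀ {i j} → scale i ≡ scale j → i ≡ j
scale-injective {zero}  {zero}  _  = refl
scale-injective {zero}  {suc j} eq =
  contradiction (sym (+-cancelˡ 1ℚ 0ℚ (scale j) (trans (ℚP.+-identityʳ 1ℚ) eq))) (1≤⇒≢0 (1≤scale j))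
scale-injective {suc i} {zero}  eq =
  contradiction (+-cancelˡ 1ℚ (scale i) 0ℚ (trans eq (sym (ℚP.+-identityʳ 1ℚ)))) (1≤⇒≢0 (1≤scale i))
scale-injective {suc i} {suc j} eq = cong suc (scale-injective (+-cancelˡ 1ℚ (scale i) (scale j) eq))

-- Finite sums and products

prodFin : ∀ k → (Fin k → ℚ) → ℚ
prodFin zero    f = 1ℚ
prodFin (suc k) f = f zero * prodFin k (λ j → f (suc j))

sumFin-cong : ∀ k {f g : Fin k → ℚ} → (∀ j → f j ≡ g j) → sumFin k f ≡ sumFin k g
sumFin-cong zero    f≗g = refl
sumFin-cong (suc k) f≗g = cong₂ _+_ (f≗g zero) (sumFin-cong k (λ j → f≗g (suc j)))

prodFin-cong : ∀ k {f g : Fin k → ℚ} → (∀ j → f j ≡ g j) → prodFin k f ≡ prodFin k g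
prodFin-cong zero    f≗g = refl
prodFin-cong (suc k) f≗g = cong₂ _*_ (f≗g zero) (prodFin-cong k (λ j → f≗g (suc j)))

sumFin-zero : ∀ k {f : Fin k → ℚ} → (∀ j → f j ≡ 0ℚ) → sumFin k f ≡ 0ℚ
sumFin-zero zero    f≗0 = refl
sumFin-zero (suc k) f≗0 = cong₂ _+_ (f≗0 zero) (sumFin-zero k (λ j → f≗0 (suc j)))

prodFin≢0 : ∀ k {f : Fin k → ℚ} → (∀ j → f j ≢ 0ℚ) → prodFin k f ≢ 0ℚ
prodFin≢0 zero    f≢0 = ℚP.1≢0
prodFin≢0 (suc k) f≢0 = *≢0 (f≢0 zero) (prodFin≢0 k (λ j → f≢0 (suc j)))

σ₁≡sumFin : ∀ k x → σ 1 k x ≡ sumFin k x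
σ₁≡sumFin zero    x = refl
σ₁≡sumFin (suc k) x = cong₂ _+_ (ℚP.*-identityʳ (x zero)) (σ₁≡sumFin k (λ j → x (suc j)))

σ-vanishes : ∀ i k x → k ℕ.< i → σ i k x ≡ 0ℚ
σ-vanishes (suc i) zero    x _         = refl
σ-vanishes (suc i) (suc k) x (s≤s k<i) = begin
  x zero * σ i k x′ + σ (suc i) k x′  ≡⟨ cong₂ (λ u v → x zero * u + v)
                                          (σ-vanishes i k x′ k<i)
                                          (σ-vanishes (suc i) k x′ (ℕP.m<n⇒m<1+n k<i)) ⟩
  x zero * 0ℚ + 0ℚ                    ≡⟨ ℚP.+-identityʳ (x zero * 0ℚ) ⟩
  x zero * 0ℚ                         ≡⟨ ℚP.*-zeroʳ (x zero) ⟩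
  0ℚ                                  ∎
  where
  open ≡-Reasoning
  x′ : Fin k → ℚ
  x′ j = x (suc j)

σₖ≡prodFin : ∀ k x → σ k k x ≡ prodFin k x
σₖ≡prodFin zero    x = refl
σₖ≡prodFin (suc k) x =
  trans (cong₂ (λ u v → x zero * u + v) (σₖ≡prodFin k _) (σ-vanishes (suc k) k _ (ℕP.n<1+n k)))
        (ℚP.+-identityʳ _)

-- Polynomials and formal derivatives

sumVars : ∀ {k} m → (Fin m → Fin k) → Poly k
sumVars zero    v = con 0ℚ
sumVars (suc m) v = var (v zero) ⊕ sumVars m (λ i → v (suc i))

prodVars : ∀ {k} m → (Fin m → Fin k) → Poly k
prodVars zero    v = con 1ℚ
prodVars (suc m) v = var (v zero) ⊗ prodVars m (λ i → v (suc i))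

⟦sumVars⟧ : ∀ {k} m (v : Fin m → Fin k) t → ⟦ sumVars m v ⟧ t ≡ sumFin m (λ i → t (v i))
⟦sumVars⟧ zero    v t = refl
⟦sumVars⟧ (suc m) v t = cong (t (v zero) +_) (⟦sumVars⟧ m (λ i → v (suc i)) t)

⟦prodVars⟧ : ∀ {k} m (v : Fin m → Fin k) t → ⟦ prodVars m v ⟧ t ≡ prodFin m (λ i → t (v i))
⟦prodVars⟧ zero    v t = refl
⟦prodVars⟧ (suc m) v t = cong (t (v zero) *_) (⟦prodVars⟧ m (λ i → v (suc i)) t)

∂-var-self : ∀ {k} (j : Fin k) t → ⟦ ∂ j (var j) ⟧ t ≡ 1ℚ
∂-var-self j t with j Fin.≟ j
... | yes _   = refl
... | no  j≢j = contradiction refl j≢j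

∂-var-other : ∀ {k} {i j : Fin k} t → i ≢ j → ⟦ ∂ j (var i) ⟧ t ≡ 0ℚ
∂-var-other {i = i} {j} t i≢j with i Fin.≟ j
... | yes i≡j = contradiction i≡j i≢j
... | no  _   = refl

∂-sumVars-fresh : ∀ {k} m (v : Fin m → Fin k) {j} t → (∀ i → v i ≢ j) →
                  ⟦ ∂ j (sumVars m v) ⟧ t ≡ 0ℚ
∂-sumVars-fresh zero    v t fresh = refl
∂-sumVars-fresh (suc m) v t fresh =
  cong₂ _+_ (∂-var-other t (fresh zero)) (∂-sumVars-fresh m _ t (λ i → fresh (suc i)))

∂-prodVars-fresh : ∀ {k} m (v : Fin m → Fin k) {j} t → (∀ i → v i ≢ j) →
                   ⟦ ∂ j (prodVars m v) ⟧ t ≡ 0ℚ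
∂-prodVars-fresh zero    v t fresh = refl
∂-prodVars-fresh (suc m) v {j} t fresh = begin
  ⟦ ∂ j (var (v zero)) ⟧ t * ⟦ Π ⟧ t + t (v zero) * ⟦ ∂ j Π ⟧ t
    ≡⟨ cong₂ (λ d d′ → d * ⟦ Π ⟧ t + t (v zero) * d′)
             (∂-var-other t (fresh zero)) (∂-prodVars-fresh m _ t (λ i → fresh (suc i))) ⟩
  0ℚ * ⟦ Π ⟧ t + t (v zero) * 0ℚ
    ≡⟨ cong₂ _+_ (ℚP.*-zeroˡ (⟦ Π ⟧ t)) (ℚP.*-zeroʳ (t (v zero))) ⟩
  0ℚ ∎
  where
  open ≡-Reasoning
  Π : Poly _
  Π = prodVars m (λ i → v (suc i))

val-polynomial : ∀ {k} (p : Poly k) t → val (p // con 1ℚ) t ≡ ⟦ p ⟧ t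
val-polynomial p t = ℚP.*-identityʳ (⟦ p ⟧ t)

dval-polynomial : ∀ {k} j (p : Poly k) t → dval j (p // con 1ℚ) t ≡ ⟦ ∂ j p ⟧ t
dval-polynomial j p t = quotient-rule (⟦ ∂ j p ⟧ t) (⟦ p ⟧ t)
  where
  quotient-rule : ∀ d v → (d * 1ℚ - v * 0ℚ) * 1ℚ ≡ d
  quotient-rule = solve-∀ ℚ-ring

-- Lower triangular determinants

LowerTriangular : ∀ {k} → (Fin k → Fin k → ℚ) → Set
LowerTriangular M = ∀ r c → r Fin.< c → M r c ≡ 0ℚ

det-lowerTriangular : ∀ k (M : Fin k → Fin k → ℚ) → LowerTriangular M →
                      det k M ≡ prodFin k (λ r → M r r)
det-lowerTriangular zero    M M-lower = refl
det-lowerTriangular (suc k) M M-lower = begin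
  1ℚ * M zero zero * det k M₁₁ + sumFin k (λ j → sign (suc j) * M zero (suc j) * minor (suc j))
    ≡⟨ cong₂ (λ d s → 1ℚ * M zero zero * d + s)
             (det-lowerTriangular k M₁₁ (λ r c r<c → M-lower (suc r) (suc c) (s≤s r<c)))
             (sumFin-zero k first-row-vanishes) ⟩
  1ℚ * M zero zero * prodFin k (λ r → M₁₁ r r) + 0ℚ
    ≡⟨ ℚP.+-identityʳ _ ⟩
  1ℚ * M zero zero * prodFin k (λ r → M₁₁ r r)
    ≡⟨ cong (_* prodFin k (λ r → M₁₁ r r)) (ℚP.*-identityˡ (M zero zero)) ⟩
  M zero zero * prodFin k (λ r → M₁₁ r r) ∎
  where
  open ≡-Reasoning
  M₁₁ : Fin k → Fin k → ℚ
  M₁₁ r c = M (suc r) (suc c)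
  minor : Fin (suc k) → ℚ
  minor j = det k (λ r c → M (suc r) (Fin.punchIn j c))
  first-row-vanishes : ∀ j → sign (suc j) * M zero (suc j) * minor (suc j) ≡ 0ℚ
  first-row-vanishes j = begin
    sign (suc j) * M zero (suc j) * minor (suc j)
      ≡⟨ cong (λ e → sign (suc j) * e * minor (suc j)) (M-lower zero (suc j) (s≤s z≤n)) ⟩
    sign (suc j) * 0ℚ * minor (suc j)
      ≡⟨ cong (_* minor (suc j)) (ℚP.*-zeroʳ (sign (suc j))) ⟩
    0ℚ * minor (suc j)
      ≡⟨ ℚP.*-zeroˡ (minor (suc j)) ⟩
    0ℚ ∎

det≢0-lowerTriangular : ∀ k (M : Fin k → Fin k → ℚ) → LowerTriangular M →
                        (∀ r → M r r ≢ 0ℚ) → det k M ≢ 0ℚ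
det≢0-lowerTriangular k M M-lower diagonal≢0 =
  subst (_≢ 0ℚ) (sym (det-lowerTriangular k M M-lower)) (prodFin≢0 k diagonal≢0)

-- The rational identities behind the construction

sum-identity : ∀ a b g s p d⁻¹ e⁻¹ → (g * g + (- b) * p) * e⁻¹ ≡ 1ℚ →
  (g * g + (- b) * p) * d⁻¹ + ((- 1ℚ) * (g * g + (- b) * p) * d⁻¹
    + (g * g * (a + (- 1ℚ) * s) * e⁻¹ + ((- b) * p * (a + (- 1ℚ) * s) * e⁻¹ + s)))
  ≡ a
sum-identity a b g s p d⁻¹ e⁻¹ ee⁻¹≡1 = begin
  (g * g + (- b) * p) * d⁻¹ + ((- 1ℚ) * (g * g + (- b) * p) * d⁻¹
    + (g * g * (a + (- 1ℚ) * s) * e⁻¹ + ((- b) * p * (a + (- 1ℚ) * s) * e⁻¹ + s)))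
    ≡⟨ solve (a ∷ b ∷ g ∷ s ∷ p ∷ d⁻¹ ∷ e⁻¹ ∷ []) ℚ-ring ⟩
  (g * g + (- b) * p) * e⁻¹ * (a + (- 1ℚ) * s) + s
    ≡⟨ cong (λ u → u * (a + (- 1ℚ) * s) + s) ee⁻¹≡1 ⟩
  1ℚ * (a + (- 1ℚ) * s) + s
    ≡⟨ solve (a ∷ s ∷ []) ℚ-ring ⟩
  a ∎
  where open ≡-Reasoning

product-identity : ∀ b g A p d⁻¹ e⁻¹ → (g * g + (- b) * p) * e⁻¹ ≡ 1ℚ → g * (A * p) * d⁻¹ ≡ 1ℚ →
  (g * g + (- b) * p) * d⁻¹ * ((- 1ℚ) * (g * g + (- b) * p) * d⁻¹
    * (g * g * A * e⁻¹ * ((- b) * p * A * e⁻¹ * p)))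
  ≡ b
product-identity b g A p d⁻¹ e⁻¹ ee⁻¹≡1 dd⁻¹≡1 = begin
  (g * g + (- b) * p) * d⁻¹ * ((- 1ℚ) * (g * g + (- b) * p) * d⁻¹
    * (g * g * A * e⁻¹ * ((- b) * p * A * e⁻¹ * p)))
    ≡⟨ solve (b ∷ g ∷ A ∷ p ∷ d⁻¹ ∷ e⁻¹ ∷ []) ℚ-ring ⟩
  (g * g + (- b) * p) * e⁻¹ * ((g * g + (- b) * p) * e⁻¹)
    * (g * (A * p) * d⁻¹ * (g * (A * p) * d⁻¹)) * b
    ≡⟨ cong₂ (λ u v → u * u * (v * v) * b) ee⁻¹≡1 dd⁻¹≡1 ⟩
  1ℚ * 1ℚ * (1ℚ * 1ℚ) * b
    ≡⟨ ℚP.*-identityˡ b ⟩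
  b ∎
  where open ≡-Reasoning

-- The numerator of the quotient rule for ∂(g²A/E)/∂β, where only g = cβ depends on β.
x₂-derivative-numerator : ∀ a b c β s p d₁ dS dP → d₁ ≡ 1ℚ → dS ≡ 0ℚ → dP ≡ 0ℚ →
  let g  = c * β
      dg = 0ℚ * β + c * d₁
      A  = a + (- 1ℚ) * s
  in  ((dg * g + g * dg) * A + g * g * (0ℚ + (0ℚ * s + (- 1ℚ) * dS))) * (g * g + (- b) * p)
        - g * g * A * ((dg * g + g * dg) + (0ℚ * p + (- b) * dP))
      ≡ (c + c) * g * A * ((- b) * p)
x₂-derivative-numerator a b c β s p _ _ _ refl refl refl = solve (a ∷ b ∷ c ∷ β ∷ s ∷ p ∷ []) ℚ-ring

a-∑[-a]≡a*scale : ∀ a k → a + (- 1ℚ) * sumFin k (λ _ → - a) ≡ a * scale k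
a-∑[-a]≡a*scale a zero    = solve (a ∷ []) ℚ-ring
a-∑[-a]≡a*scale a (suc k) = begin
  a + (- 1ℚ) * (- a + ∑)   ≡⟨ regroup a ∑ ⟩
  a + (a + (- 1ℚ) * ∑)     ≡⟨ cong (a +_) (a-∑[-a]≡a*scale a k) ⟩
  a + a * scale k          ≡⟨ factor a (scale k) ⟩
  a * (1ℚ + scale k)       ∎
  where
  open ≡-Reasoning
  ∑ : ℚ
  ∑ = sumFin k (λ _ → - a)
  regroup : ∀ a s → a + (- 1ℚ) * (- a + s) ≡ a + (a + (- 1ℚ) * s)
  regroup = solve-∀ ℚ-ring
  factor : ∀ a c → a + a * c ≡ a * (1ℚ + c)
  factor = solve-∀ ℚ-ring

-- The construction, for n = 4 + m

module Construction (m : ℕ) (a b : ℚ) where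

  β : Fin (suc m)
  β = fromℕ m

  β-fresh : ∀ i → inject₁ i ≢ β
  β-fresh i inject₁[i]≡β = FinP.fromℕ≢inject₁ (sym inject₁[i]≡β)

  S P A : Poly (suc m)
  S = sumVars m inject₁
  P = prodVars m inject₁
  A = con a ⊕ (con (- 1ℚ) ⊗ S)

  G E D : ℚ → Poly (suc m)
  G c = con c ⊗ var β
  E c = (G c ⊗ G c) ⊕ (con (- b) ⊗ P)
  D c = G c ⊗ (A ⊗ P)

  x : ℚ → Tuple (4 ℕ.+ m) (suc m)
  x c zero                      = E c // D c
  x c (suc zero)                = (con (- 1ℚ) ⊗ E c) // D c
  x c (suc (suc zero))          = ((G c ⊗ G c) ⊗ A) // E c
  x c (suc (suc (suc zero)))    = ((con (- b) ⊗ P) ⊗ A) // E c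
  x c (suc (suc (suc (suc i)))) = var (inject₁ i) // con 1ℚ

  solves : ∀ c → SolvesIdentically (4 ℕ.+ m) a b (x c)
  solves c t defined = sum≡a , product≡b
    where
    open ≡-Reasoning
    y : Fin (4 ℕ.+ m) → ℚ
    y k = val (x c k) t
    y₀ y₁ y₂ y₃ : ℚ
    y₀ = y zero
    y₁ = y (suc zero)
    y₂ = y (suc (suc zero))
    y₃ = y (suc (suc (suc zero)))
    y-free : Fin m → ℚ
    y-free i = y (suc (suc (suc (suc i))))
    E-inverse : ⟦ E c ⟧ t * inv (⟦ E c ⟧ t) ≡ 1ℚ
    E-inverse = *-inv (defined (suc (suc zero)))
    D-inverse : ⟦ D c ⟧ t * inv (⟦ D c ⟧ t) ≡ 1ℚ
    D-inverse = *-inv (defined zero)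
    sum≡a : σ 1 (4 ℕ.+ m) y ≡ a
    sum≡a = begin
      σ 1 (4 ℕ.+ m) y
        ≡⟨ σ₁≡sumFin (4 ℕ.+ m) y ⟩
      y₀ + (y₁ + (y₂ + (y₃ + sumFin m y-free)))
        ≡⟨ cong (λ s → y₀ + (y₁ + (y₂ + (y₃ + s))))
                (trans (sumFin-cong m (λ i → val-polynomial (var (inject₁ i)) t))
                       (sym (⟦sumVars⟧ m inject₁ t))) ⟩
      y₀ + (y₁ + (y₂ + (y₃ + ⟦ S ⟧ t)))
        ≡⟨ sum-identity a b (c * t β) (⟦ S ⟧ t) (⟦ P ⟧ t) _ _ E-inverse ⟩
      a ∎
    product≡b : σ (4 ℕ.+ m) (4 ℕ.+ m) y ≡ b
    product≡b = begin
      σ (4 ℕ.+ m) (4 ℕ.+ m) y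
        ≡⟨ σₖ≡prodFin (4 ℕ.+ m) y ⟩
      y₀ * (y₁ * (y₂ * (y₃ * prodFin m y-free)))
        ≡⟨ cong (λ p → y₀ * (y₁ * (y₂ * (y₃ * p))))
                (trans (prodFin-cong m (λ i → val-polynomial (var (inject₁ i)) t))
                       (sym (⟦prodVars⟧ m inject₁ t))) ⟩
      y₀ * (y₁ * (y₂ * (y₃ * ⟦ P ⟧ t)))
        ≡⟨ product-identity b (c * t β) (⟦ A ⟧ t) (⟦ P ⟧ t) _ _ E-inverse D-inverse ⟩
      b ∎

  ∂x₂/∂β : ∀ c t → dval β (x c (suc (suc zero))) t
            ≡ (c + c) * (c * t β) * ⟦ A ⟧ t * ((- b) * ⟦ P ⟧ t) * inv (⟦ E c ⟧ t * ⟦ E c ⟧ t)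
  ∂x₂/∂β c t = cong (_* inv (⟦ E c ⟧ t * ⟦ E c ⟧ t))
    (x₂-derivative-numerator a b c (t β) (⟦ S ⟧ t) (⟦ P ⟧ t) _ _ _
      (∂-var-self β t) (∂-sumVars-fresh m inject₁ t β-fresh) (∂-prodVars-fresh m inject₁ t β-fresh))

  jacobianRow : ∀ {r : Fin (suc m)} → View r → Fin (4 ℕ.+ m)
  jacobianRow ‵fromℕ       = suc (suc zero)
  jacobianRow (‵inject₁ i) = suc (suc (suc (suc i)))

  jacobianRow-injective : ∀ {r r′ : Fin (suc m)} (v : View r) (v′ : View r′) →
                          jacobianRow v ≡ jacobianRow v′ → r ≡ r′
  jacobianRow-injective ‵fromℕ       ‵fromℕ        _    = refl
  jacobianRow-injective (‵inject₁ i) (‵inject₁ .i) refl = refl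

  jacobian-lowerTriangular : ∀ c t → LowerTriangular (λ r j → dval j (x c (jacobianRow (view r))) t)
  jacobian-lowerTriangular c t r j r<j = row (view r) r<j
    where
    row : ∀ {r} (v : View r) → r Fin.< j → dval j (x c (jacobianRow v)) t ≡ 0ℚ
    row ‵fromℕ       β<j = contradiction (FinP.≤fromℕ j) (ℕP.<⇒≱ β<j)
    row (‵inject₁ i) i<j = trans (dval-polynomial j (var (inject₁ i)) t)
                                 (∂-var-other t (λ i≡j → ℕP.<-irrefl (cong toℕ i≡j) i<j))

  module AtPoint (a≢0 : a ≢ 0ℚ) (b≢0 : b ≢ 0ℚ) where

    p₀ β₀ : ℚ
    p₀ = prodFin m (λ _ → - a)
    β₀ = ∣ b * p₀ ∣ + 1ℚ

    t₀ : Fin (suc m) → ℚ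
    t₀ = updateAt (λ _ → - a) β (λ _ → β₀)

    t₀-free : ∀ i → t₀ (inject₁ i) ≡ - a
    t₀-free i = updateAt-minimal (inject₁ i) β _ (β-fresh i)

    t₀-β : t₀ β ≡ β₀
    t₀-β = updateAt-updates β _

    1≤β₀ : 1ℚ ℚ.≤ β₀
    1≤β₀ = ℚP.+-monoˡ-≤ 1ℚ (ℚP.0≤∣p∣ (b * p₀))

    t₀-β≢0 : t₀ β ≢ 0ℚ
    t₀-β≢0 = subst (_≢ 0ℚ) (sym t₀-β) (1≤⇒≢0 1≤β₀)

    ⟦P⟧≡p₀ : ⟦ P ⟧ t₀ ≡ p₀
    ⟦P⟧≡p₀ = trans (⟦prodVars⟧ m inject₁ t₀) (prodFin-cong m t₀-free)

    ⟦A⟧≡a*scale : ⟦ A ⟧ t₀ ≡ a * scale m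
    ⟦A⟧≡a*scale = trans (cong (λ s → a + (- 1ℚ) * s) (trans (⟦sumVars⟧ m inject₁ t₀) (sumFin-cong m t₀-free)))
                        (a-∑[-a]≡a*scale a m)

    P≢0 : ⟦ P ⟧ t₀ ≢ 0ℚ
    P≢0 = subst (_≢ 0ℚ) (sym ⟦P⟧≡p₀) (prodFin≢0 m (λ _ → neg≢0 a≢0))

    A≢0 : ⟦ A ⟧ t₀ ≢ 0ℚ
    A≢0 = subst (_≢ 0ℚ) (sym ⟦A⟧≡a*scale) (*≢0 a≢0 (1≤⇒≢0 (1≤scale m)))

    module _ {c : ℚ} (1≤c : 1ℚ ℚ.≤ c) where

      β₀≤cβ₀ : β₀ ℚ.≤ c * β₀
      β₀≤cβ₀ = p≤c*p 1≤c (ℚP.≤-trans (ℚP.<⇒≤ 0<1) 1≤β₀)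

      G≢0 : ⟦ G c ⟧ t₀ ≢ 0ℚ
      G≢0 = subst (_≢ 0ℚ) (cong (c *_) (sym t₀-β)) (1≤⇒≢0 (ℚP.≤-trans 1≤β₀ β₀≤cβ₀))

      E≢0 : ⟦ E c ⟧ t₀ ≢ 0ℚ
      E≢0 E≡0 = ∣q∣<p⇒p*p≢q ∣bp₀∣<cβ₀ (ℚP.≤-trans 1≤β₀ β₀≤cβ₀) (x∙y⁻¹≈ε⇒x≈y _ _ [cβ₀]²-bp₀≡0)
        where
        open ≡-Reasoning
        ∣bp₀∣<cβ₀ : ∣ b * p₀ ∣ ℚ.< c * β₀
        ∣bp₀∣<cβ₀ = ℚP.<-≤-trans (subst (ℚ._< β₀) (ℚP.+-identityʳ _) (ℚP.+-monoʳ-< ∣ b * p₀ ∣ 0<1)) β₀≤cβ₀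
        [cβ₀]²-bp₀≡0 : c * β₀ * (c * β₀) - b * p₀ ≡ 0ℚ
        [cβ₀]²-bp₀≡0 = begin
          c * β₀ * (c * β₀) - b * p₀      ≡⟨ cong (c * β₀ * (c * β₀) +_) (ℚP.neg-distribˡ-* b p₀) ⟩
          c * β₀ * (c * β₀) + (- b) * p₀  ≡⟨ cong₂ (λ u v → c * u * (c * u) + (- b) * v) t₀-β ⟦P⟧≡p₀ ⟨
          ⟦ E c ⟧ t₀                      ≡⟨ E≡0 ⟩
          0ℚ                              ∎

      D≢0 : ⟦ D c ⟧ t₀ ≢ 0ℚ
      D≢0 = *≢0 G≢0 (*≢0 A≢0 P≢0)

      defined : AllDefinedAt (x c) t₀
      defined zero                      = D≢0
      defined (suc zero)                = D≢0
      defined (suc (suc zero))          = E≢0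
      defined (suc (suc (suc zero)))    = E≢0
      defined (suc (suc (suc (suc i)))) = ℚP.1≢0

      jacobian-diagonal≢0 : ∀ r → dval r (x c (jacobianRow (view r))) t₀ ≢ 0ℚ
      jacobian-diagonal≢0 r = diagonal (view r)
        where
        c+c≢0 : c + c ≢ 0ℚ
        c+c≢0 = 0<⇒≢0 (ℚP.+-mono-< (1≤⇒0< 1≤c) (1≤⇒0< 1≤c))
        diagonal : ∀ {r} (v : View r) → dval r (x c (jacobianRow v)) t₀ ≢ 0ℚ
        diagonal ‵fromℕ       = subst (_≢ 0ℚ) (sym (∂x₂/∂β c t₀))
          (*≢0 (*≢0 (*≢0 (*≢0 c+c≢0 G≢0) A≢0) (*≢0 (neg≢0 b≢0) P≢0)) (inv≢0 (*≢0 E≢0 E≢0)))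
        diagonal (‵inject₁ i) = subst (_≢ 0ℚ)
          (sym (trans (dval-polynomial (inject₁ i) (var (inject₁ i)) t₀) (∂-var-self (inject₁ i) t₀)))
          ℚP.1≢0

      independent : IndependentParams (4 ℕ.+ m) (suc m) (x c)
      independent = t₀ , defined , (λ r → jacobianRow (view r)) , jacobianRow-injective (view _) (view _)
                  , det≢0-lowerTriangular (suc m) _ (jacobian-lowerTriangular c t₀) jacobian-diagonal≢0

    x₃-separates : ∀ {c d} → 1ℚ ℚ.≤ c → 1ℚ ℚ.≤ d → c ≢ d →
                   val (x c (suc (suc (suc zero)))) t₀ ≢ val (x d (suc (suc (suc zero)))) t₀
    x₃-separates {c} {d} 1≤c 1≤d c≢d x₃[c]≡x₃[d] =
      *≢0 (p≢q⇒p-q≢0 c≢d) (*≢0 c+d≢0 (*≢0 t₀-β≢0 t₀-β≢0)) factored-difference≡0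
      where
      open ≡-Reasoning
      c+d≢0 : c + d ≢ 0ℚ
      c+d≢0 = 0<⇒≢0 (ℚP.+-mono-< (1≤⇒0< 1≤c) (1≤⇒0< 1≤d))
      E[c]≡E[d] : ⟦ E c ⟧ t₀ ≡ ⟦ E d ⟧ t₀
      E[c]≡E[d] = inv-injective (E≢0 1≤c) (E≢0 1≤d)
                    (*-cancelˡ (*≢0 (*≢0 (neg≢0 b≢0) P≢0) A≢0) x₃[c]≡x₃[d])
      difference : ∀ c d β q → (c * β * (c * β) + q) - (d * β * (d * β) + q) ≡ (c - d) * ((c + d) * (β * β))
      difference = solve-∀ ℚ-ring
      factored-difference≡0 : (c - d) * ((c + d) * (t₀ β * t₀ β)) ≡ 0ℚ
      factored-difference≡0 = begin
        (c - d) * ((c + d) * (t₀ β * t₀ β))  ≡⟨ difference c d (t₀ β) ((- b) * ⟦ P ⟧ t₀) ⟨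
        ⟦ E c ⟧ t₀ - ⟦ E d ⟧ t₀              ≡⟨ cong (_- ⟦ E d ⟧ t₀) E[c]≡E[d] ⟩
        ⟦ E d ⟧ t₀ - ⟦ E d ⟧ t₀              ≡⟨ ℚP.+-inverseʳ (⟦ E d ⟧ t₀) ⟩
        0ℚ                                   ∎

theorem1 : (n : ℕ) → 4 ≤ n → (a b : ℚ) → a ≢ 0ℚ → b ≢ 0ℚ →
    Σ (ℕ → Tuple n (n ∸ 3)) λ sol →
      ((i : ℕ) → SolvesIdentically n a b (sol i) × IndependentParams n (n ∸ 3) (sol i))
      × ((i j : ℕ) → i ≢ j → DistinctTuples (sol i) (sol j))
theorem1 (suc (suc (suc (suc m)))) (s≤s (s≤s (s≤s (s≤s z≤n)))) a b a≢0 b≢0 =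
  (λ i → x (scale i)) ,
  (λ i → solves (scale i) , independent (1≤scale i)) ,
  λ i j i≢j → t₀ , defined (1≤scale i) , defined (1≤scale j) , suc (suc (suc zero)) ,
    x₃-separates (1≤scale i) (1≤scale j) (λ eq → i≢j (scale-injective eq))
  where
  open Construction m a b
  open AtPoint a≢0 b≢0
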